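{- Let $n\ge 1$ and let $a,b$ be positive integers with $a,b\le 2^{n-1}$ and $2^{n-1}\le a+b\le 2^n$. Then $(a,b)$ is fit in $Q_{n+1}$ if and only if $(2^n-a,2^n-b)$ is fit in $Q_{n+1}$. Consequently, the number of pairs unfit in $Q_{n+1}$ in the set $\{(a,b)\in\mathbb{Z}_{>0}^2: a,b\le 2^{n-1},\ 2^{n-1}\le a+b\le 2^n\}$ equals the number of pairs unfit in $Q_{n+1}$ in the set $\{(a,b)\in\mathbb{Z}_{>0}^2: a,b\ge 2^{n-1},\ a+b\le 2^n+2^{n-1}\}$.
   Context: $Q_N=\{0,1\}^N$ is the hypercube graph (binary strings $x_0\ldots x_{N-1}$, adjacent iff they differ in exactly one digit), with automorphism group $\mathrm{Aut}(Q_N)$. Strings are identified with integers $\sum_i x_i2^{N-1-i}$; for $0\le k\le 2^N$, $I_k\subseteq Q_N$ is the set of strings with value $<k$. A pair of positive integers $(a,b)$ with $a+b\le 2^N$ is fit in $Q_N$ if there exist $g_1,g_2\in\mathrm{Aut}(Q_N)$ with $g_1(I_a)\cup g_2(I_b)=I_{a+b}$, and unfit in $Q_N$ otherwise. -}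

module Defs where

open import Data.Bool using (Bool; true; false; if_then_else_; _∧_; not; _≟_)
open import Data.Nat using (ℕ; zero; suc; _+_; _^_; _<_; _≤ᵇ_)
open import Data.Vec using (Vec; []; _∷_)
open import Data.List using (List; map; upTo; concatMap)
open import Data.Nat.ListAction using (sum)
open import Data.Product using (Σ; ∃; _×_; _,_)
open import Data.Sum using (_⊎_)
open import Relation.Binary.PropositionalEquality using (_≡_)
open import Relation.Nullary using (Dec; ¬_)
open import Relation.Nullary.Decidable using (⌊_⌋)
open import Function.Bundles using (_⇔_)

V : ℕ → Set
V N = Vec Bool N

hamming : ∀ {N} → V N → V N → ℕ
hamming [] [] = 0
hamming (x ∷ xs) (y ∷ ys) = (if ⌊ x ≟ y ⌋ then 0 else 1) + hamming xs ys

Adj : ∀ {N} → V N → V N → Set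
Adj x y = hamming x y ≡ 1

record Aut (N : ℕ) : Set where
  field
    fun     : V N → V N
    inv     : V N → V N
    inv-l   : ∀ x → inv (fun x) ≡ x
    inv-r   : ∀ y → fun (inv y) ≡ y
    adj-iff : ∀ x y → Adj x y ⇔ Adj (fun x) (fun y)
open Aut public

-- value of a string: Σ x_i 2^{N-1-i}  (x_0 is the most significant digit)
val : ∀ {N} → V N → ℕ
val {zero} [] = 0
val {suc N} (b ∷ xs) = (if b then 2 ^ N else 0) + val xs

InI : ∀ {N} → ℕ → V N → Set
InI k x = val x < k

Fit : ℕ → ℕ → ℕ → Set
Fit N a b = Σ (Aut N) λ g₁ → Σ (Aut N) λ g₂ → ∀ (y : V N) →
  ((∃ λ x → InI a x × fun g₁ x ≡ y) ⊎ (∃ λ x → InI b x × fun g₂ x ≡ y))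
  ⇔ InI (a + b) y

Unfit : ℕ → ℕ → ℕ → Set
Unfit N a b = ¬ Fit N a b

countPairs : ℕ → (ℕ → ℕ → Bool) → ℕ
countPairs M p = sum (concatMap (λ a → map (λ b → if p a b then 1 else 0) (upTo M)) (upTo M))

-- S₁(h) = {(a,b) ∈ ℤ_{>0}² : a,b ≤ h, h ≤ a+b ≤ 2h}   (h = 2^{n-1})
inS₁ : ℕ → ℕ → ℕ → Bool
inS₁ h a b = (1 ≤ᵇ a) ∧ (1 ≤ᵇ b) ∧ (a ≤ᵇ h) ∧ (b ≤ᵇ h) ∧ (h ≤ᵇ (a + b)) ∧ ((a + b) ≤ᵇ (h + h))

inS₂ : ℕ → ℕ → ℕ → Bool
inS₂ h a b = (1 ≤ᵇ a) ∧ (1 ≤ᵇ b) ∧ (h ≤ᵇ a) ∧ (h ≤ᵇ b) ∧ ((a + b) ≤ᵇ ((h + h) + h))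

-- number of pairs in S (given as boolean predicate) unfit in Q_N, computed via
-- an (arbitrary) decision procedure d for fitness; the bound M must exceed all coordinates
countUnfit : (N M : ℕ) → (d : ∀ a b → Dec (Fit N a b)) → (ℕ → ℕ → Bool) → ℕ
countUnfit N M d S = countPairs M (λ a b → S a b ∧ not ⌊ d a b ⌋)

{-# OPTIONS --safe #-}
-- Automorphisms of the cube are isometries of the Hamming distance, hence map coordinate faces to
-- coordinate faces. Write a fit of (a, b) as automorphisms φ₁, φ₂ with φ₁⁻¹(I_a) ∪ φ₂⁻¹(I_b) = I_{a+b};
-- counting shows the union is disjoint. Each preimage lies in a coordinate face, a half cube, and within
-- that face its relative complement is the preimage of I_{2^n-a} (resp. I_{2^n-b}) under another
-- automorphism. Two faces whose union contains the relevant small vertices are either opposite, or one of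
-- them is the face of a leading coordinate. In each case the relative complements of the two preimages
-- tile the complement of I_{a+b}, which an explicit automorphism turns into the initial segment of the
-- complementary pair; the converse runs the same way. For the count, (a, b) ↦ (2^n - a, 2^n - b) maps the
-- unfit pairs of the second set onto those of the first, and the two pairs of the second set without a
-- partner are fit.
module Submission where

open import Defs
open import Data.Bool using (Bool; true; false; not; _xor_; _∧_; _∨_; if_then_else_; T)
  renaming (_≟_ to _≟ᵇ_)
open import Data.Bool.Properties using (¬-not; not-¬; xor-comm; T-∧; T-≡; ⇔→≡)
open import Data.Empty using (⊥-elim)
open import Data.Fin using (Fin; zero; suc; toℕ; fromℕ<) renaming (_≟_ to _≟ᶠ_)
open import Data.Fin.Permutation using (Permutation; permutation)
open import Data.Fin.Properties using (toℕ-fromℕ<; toℕ<n; toℕ-injective)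
open import Data.List using (List; []; _∷_; _++_; [_]; map; upTo; applyUpTo; downFrom; reverse; concatMap)
open import Data.List.Properties
  using (map-++; map-∘; map-cong-local; upTo-∷ʳ; reverse-upTo; map-upTo; map-applyUpTo)
open import Data.List.Membership.Propositional.Properties using (∈-upTo⁻)
open import Data.List.Relation.Binary.Permutation.Propositional.Properties using (↭-reverse; map⁺)
import Data.List.Relation.Unary.All as All
open import Data.Nat using (ℕ; zero; suc; _+_; _∸_; _^_; _≤_; _<_; _≮_; _≤ᵇ_; z≤n; s≤s)
open import Data.Nat.ListAction using (sum)
open import Data.Nat.ListAction.Properties using (sum-++; sum-↭)
open import Data.Nat.Properties
open import Data.Nat.Solver using (module +-*-Solver)
open import Algebra.Properties.CommutativeMonoid.Sum +-0-commutativeMonoid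
  using (sum-syntax; sum-permute; sum-cong-≗; ∑-distrib-+)
open import Algebra.Properties.CommutativeSemigroup +-commutativeSemigroup
  using (interchange; xy∙z≈zy∙x; x∙yz≈y∙xz)
open import Data.Product using (∃-syntax; ∃₂; _×_; _,_; proj₁; proj₂)
open import Data.Product.Function.NonDependent.Propositional using (_×-⇔_)
open import Data.Sum using (_⊎_; inj₁; inj₂; [_,_]′) renaming (swap to ⊎-swap; map to ⊎-map)
open import Data.Sum.Function.Propositional using (_⊎-⇔_)
open import Data.Vec using ([]; _∷_; lookup; replicate; zipWith; _[_]≔_; _[_]%=_)
open import Data.Vec.Properties
  using (lookup-replicate; lookup-zipWith; lookup∘update; lookup∘update′; lookup∘updateAt; lookup∘updateAt′;
         []≔-idempotent; []≔-lookup)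
open import Function using (_∘_; id)
open import Function.Bundles using (_⇔_; mk⇔; Equivalence)
open import Function.Properties.Equivalence using ()
  renaming (refl to ⇔-refl; sym to ⇔-sym; trans to ⇔-trans)
open import Relation.Binary.PropositionalEquality
  using (_≡_; _≢_; refl; sym; trans; cong; cong₂; subst; subst₂; module ≡-Reasoning)
open import Relation.Nullary using (¬_; Dec; yes; no; does; contradiction)
open import Relation.Nullary.Decidable
  using (⌊_⌋; _×-dec_; _⊎-dec_; does-⇔; dec-true; toSum; toWitnessFalse; fromWitnessFalse)

open Equivalence using (to; from)
open +-*-Solver using (solve; _:+_; _:=_; con)

private variable
  N n m a b d k k′ k₁ k₂ k₁′ k₂′ t t′ s s′ x y x′ y′ : ℕ
  p : Fin N
  β : Bool

-- Hamming distance and automorphisms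

diff : Bool → Bool → ℕ
diff a b = if ⌊ a ≟ᵇ b ⌋ then 0 else 1

diff-triangle : ∀ a b c → diff a c ≤ diff a b + diff b c
diff-triangle false false false = z≤n
diff-triangle false false true  = ≤-refl
diff-triangle false true  false = z≤n
diff-triangle false true  true  = ≤-refl
diff-triangle true  false false = ≤-refl
diff-triangle true  false true  = z≤n
diff-triangle true  true  false = ≤-refl
diff-triangle true  true  true  = z≤n

hamming-refl : (x : V N) → hamming x x ≡ 0
hamming-refl []           = refl
hamming-refl (false ∷ xs) = hamming-refl xs
hamming-refl (true ∷ xs)  = hamming-refl xs

hamming≡0⇒≡ : (x y : V N) → hamming x y ≡ 0 → x ≡ y
hamming≡0⇒≡ []           []           _ = refl
hamming≡0⇒≡ (false ∷ xs) (false ∷ ys) e = cong (false ∷_) (hamming≡0⇒≡ xs ys e)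
hamming≡0⇒≡ (true ∷ xs)  (true ∷ ys)  e = cong (true ∷_) (hamming≡0⇒≡ xs ys e)
hamming≡0⇒≡ (false ∷ xs) (true ∷ ys)  ()
hamming≡0⇒≡ (true ∷ xs)  (false ∷ ys) ()

hamming-triangle : (x y z : V N) → hamming x z ≤ hamming x y + hamming y z
hamming-triangle []       []       []       = z≤n
hamming-triangle (a ∷ xs) (b ∷ ys) (c ∷ zs) = begin
  diff a c + hamming xs zs                                   ≤⟨ +-mono-≤ (diff-triangle a b c) (hamming-triangle xs ys zs) ⟩
  (diff a b + diff b c) + (hamming xs ys + hamming ys zs)    ≡⟨ interchange (diff a b) _ _ _ ⟩
  (diff a b + hamming xs ys) + (diff b c + hamming ys zs)    ∎
  where open ≤-Reasoning

hamming-step : (x y : V N) → hamming x y ≡ suc d → ∃[ x′ ] Adj x x′ × hamming x′ y ≡ d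
hamming-step []           []           ()
hamming-step (false ∷ xs) (true ∷ ys)  e = true ∷ xs , cong suc (hamming-refl xs) , suc-injective e
hamming-step (true ∷ xs)  (false ∷ ys) e = false ∷ xs , cong suc (hamming-refl xs) , suc-injective e
hamming-step (false ∷ xs) (false ∷ ys) e with x′ , adj , e′ ← hamming-step xs ys e = false ∷ x′ , adj , e′
hamming-step (true ∷ xs)  (true ∷ ys)  e with x′ , adj , e′ ← hamming-step xs ys e = true ∷ x′ , adj , e′

Aut-contracts : (G : Aut N) (x y : V N) → hamming (fun G x) (fun G y) ≤ hamming x y
Aut-contracts G x y = go x y refl
  where
  go : ∀ {d} x y → hamming x y ≡ d → hamming (fun G x) (fun G y) ≤ d
  go {zero}  x y e rewrite hamming≡0⇒≡ x y e | hamming-refl (fun G y) = z≤n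
  go {suc d} x y e with x′ , adj , e′ ← hamming-step x y e = begin
    hamming (fun G x) (fun G y)                                  ≤⟨ hamming-triangle (fun G x) (fun G x′) (fun G y) ⟩
    hamming (fun G x) (fun G x′) + hamming (fun G x′) (fun G y)
      ≤⟨ +-mono-≤ (≤-reflexive (to (adj-iff G x x′) adj)) (go x′ y e′) ⟩
    suc d                                                        ∎
    where open ≤-Reasoning

infix 10 _⁻¹ᴬ
infixr 9 _∘ᴬ_

_⁻¹ᴬ : Aut N → Aut N
G ⁻¹ᴬ = record
  { fun     = inv G
  ; inv     = fun G
  ; inv-l   = inv-r G
  ; inv-r   = inv-l G
  ; adj-iff = λ x y → ⇔-sym (subst₂ (λ u v → Adj (inv G x) (inv G y) ⇔ Adj u v)
                               (inv-r G x) (inv-r G y) (adj-iff G (inv G x) (inv G y)))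
  }

_∘ᴬ_ : Aut N → Aut N → Aut N
F ∘ᴬ G = record
  { fun     = fun F ∘ fun G
  ; inv     = inv G ∘ inv F
  ; inv-l   = λ x → trans (cong (inv G) (inv-l F (fun G x))) (inv-l G x)
  ; inv-r   = λ y → trans (cong (fun F) (inv-r G (inv F y))) (inv-r F y)
  ; adj-iff = λ x y → ⇔-trans (adj-iff G x y) (adj-iff F (fun G x) (fun G y))
  }

idᴬ : Aut N
idᴬ = record { fun = id ; inv = id ; inv-l = λ _ → refl ; inv-r = λ _ → refl ; adj-iff = λ _ _ → ⇔-refl }

Aut-isometry : (G : Aut N) (x y : V N) → hamming (fun G x) (fun G y) ≡ hamming x y
Aut-isometry G x y = ≤-antisym (Aut-contracts G x y)
  (subst₂ (λ u v → hamming u v ≤ _) (inv-l G x) (inv-l G y) (Aut-contracts (G ⁻¹ᴬ) (fun G x) (fun G y)))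

isometricInvolution : (f : V N → V N) → (∀ x → f (f x) ≡ x) →
  (∀ x y → hamming (f x) (f y) ≡ hamming x y) → Aut N
isometricInvolution f f∘f≗id iso = record
  { fun = f ; inv = f ; inv-l = f∘f≗id ; inv-r = f∘f≗id
  ; adj-iff = λ x y → mk⇔ (trans (iso x y)) (trans (sym (iso x y)))
  }

infixr 6 _⊕_
_⊕_ : V N → V N → V N
_⊕_ = zipWith _xor_

⊕-involutive : (c x : V N) → c ⊕ (c ⊕ x) ≡ x
⊕-involutive []           []           = refl
⊕-involutive (false ∷ cs) (x ∷ xs)     = cong (x ∷_) (⊕-involutive cs xs)
⊕-involutive (true ∷ cs)  (false ∷ xs) = cong (false ∷_) (⊕-involutive cs xs)
⊕-involutive (true ∷ cs)  (true ∷ xs)  = cong (true ∷_) (⊕-involutive cs xs)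

⊕-identityˡ : (x : V N) → replicate N false ⊕ x ≡ x
⊕-identityˡ []       = refl
⊕-identityˡ (x ∷ xs) = cong (x ∷_) (⊕-identityˡ xs)

diff-not : ∀ a b → diff (not a) (not b) ≡ diff a b
diff-not false false = refl
diff-not false true  = refl
diff-not true  false = refl
diff-not true  true  = refl

hamming-⊕ : (c x y : V N) → hamming (c ⊕ x) (c ⊕ y) ≡ hamming x y
hamming-⊕ []           []       []       = refl
hamming-⊕ (false ∷ cs) (a ∷ xs) (b ∷ ys) = cong (diff a b +_) (hamming-⊕ cs xs ys)
hamming-⊕ (true ∷ cs)  (a ∷ xs) (b ∷ ys) = cong₂ _+_ (diff-not a b) (hamming-⊕ cs xs ys)

translation : V N → Aut N
translation c = isometricInvolution (c ⊕_) (⊕-involutive c) (hamming-⊕ c)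

hamming-update : (j : Fin N) (x y : V N) (a b : Bool) →
  hamming (x [ j ]≔ a) (y [ j ]≔ b) + diff (lookup x j) (lookup y j) ≡ hamming x y + diff a b
hamming-update zero    (u ∷ xs) (v ∷ ys) a b = xy∙z≈zy∙x (diff a b) (hamming xs ys) (diff u v)
hamming-update (suc j) (u ∷ xs) (v ∷ ys) a b = begin
  (diff u v + hamming (xs [ j ]≔ a) (ys [ j ]≔ b)) + diff (lookup xs j) (lookup ys j)
    ≡⟨ +-assoc (diff u v) _ _ ⟩
  diff u v + (hamming (xs [ j ]≔ a) (ys [ j ]≔ b) + diff (lookup xs j) (lookup ys j))
    ≡⟨ cong (diff u v +_) (hamming-update j xs ys a b) ⟩
  diff u v + (hamming xs ys + diff a b)
    ≡⟨ +-assoc (diff u v) _ _ ⟨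
  (diff u v + hamming xs ys) + diff a b ∎
  where open ≡-Reasoning

swap₀ : Fin N → V N → V N
swap₀ zero    x       = x
swap₀ (suc j) (a ∷ w) = lookup w j ∷ (w [ j ]≔ a)

hamming-swap₀ : (j : Fin N) (x y : V N) → hamming (swap₀ j x) (swap₀ j y) ≡ hamming x y
hamming-swap₀ zero    x       y       = refl
hamming-swap₀ (suc j) (a ∷ w) (b ∷ v) = begin
  diff (lookup w j) (lookup v j) + hamming (w [ j ]≔ a) (v [ j ]≔ b) ≡⟨ +-comm (diff (lookup w j) (lookup v j)) _ ⟩
  hamming (w [ j ]≔ a) (v [ j ]≔ b) + diff (lookup w j) (lookup v j) ≡⟨ hamming-update j w v a b ⟩
  hamming w v + diff a b                                             ≡⟨ +-comm (hamming w v) _ ⟩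
  diff a b + hamming w v                                             ∎
  where open ≡-Reasoning

swap₀-involutive : (j : Fin N) (x : V N) → swap₀ j (swap₀ j x) ≡ x
swap₀-involutive zero    x       = refl
swap₀-involutive (suc j) (a ∷ w) = cong₂ _∷_ (lookup∘update j w a) (trans ([]≔-idempotent w j) ([]≔-lookup w j))

lookup-swap₀ : (j : Fin (suc N)) (x : V (suc N)) → lookup (swap₀ j x) zero ≡ lookup x j
lookup-swap₀ zero    x       = refl
lookup-swap₀ (suc j) (a ∷ w) = refl

swap₀-fixes : (j : Fin (suc N)) (x : V (suc N)) → lookup x zero ≡ lookup x j → swap₀ j x ≡ x
swap₀-fixes zero    x       _    = refl
swap₀-fixes (suc j) (a ∷ w) refl = cong (lookup w j ∷_) ([]≔-lookup w j)

swap : Fin N → Aut N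
swap j = isometricInvolution (swap₀ j) (swap₀-involutive j) (hamming-swap₀ j)

-- Automorphisms permute and flip coordinates

flipAt : Fin N → V N → V N
flipAt k x = x [ k ]%= not

hamming-flipAt : (k : Fin N) (x : V N) → hamming x (flipAt k x) ≡ 1
hamming-flipAt zero    (false ∷ xs) = cong suc (hamming-refl xs)
hamming-flipAt zero    (true ∷ xs)  = cong suc (hamming-refl xs)
hamming-flipAt (suc k) (false ∷ xs) = hamming-flipAt k xs
hamming-flipAt (suc k) (true ∷ xs)  = hamming-flipAt k xs

hamming≡1⇒flipAt : (x y : V N) → hamming x y ≡ 1 → ∃[ k ] y ≡ flipAt k x
hamming≡1⇒flipAt []           []           ()
hamming≡1⇒flipAt (false ∷ xs) (true ∷ ys)  e = zero , cong (true ∷_) (sym (hamming≡0⇒≡ xs ys (suc-injective e)))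
hamming≡1⇒flipAt (true ∷ xs)  (false ∷ ys) e = zero , cong (false ∷_) (sym (hamming≡0⇒≡ xs ys (suc-injective e)))
hamming≡1⇒flipAt (false ∷ xs) (false ∷ ys) e with k , ys≡ ← hamming≡1⇒flipAt xs ys e = suc k , cong (false ∷_) ys≡
hamming≡1⇒flipAt (true ∷ xs)  (true ∷ ys)  e with k , ys≡ ← hamming≡1⇒flipAt xs ys e = suc k , cong (true ∷_) ys≡

agree⇔flipAt-farther : (k : Fin N) (y z : V N) →
  lookup y k ≡ lookup z k ⇔ hamming y z < hamming y (flipAt k z)
agree⇔flipAt-farther zero (a ∷ ys) (c ∷ zs) = head a c
  where
  h = hamming ys zs
  head : ∀ a c → a ≡ c ⇔ diff a c + h < diff a (not c) + h
  head false false = mk⇔ (λ _ → n<1+n h) (λ _ → refl)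
  head true  true  = mk⇔ (λ _ → n<1+n h) (λ _ → refl)
  head false true  = mk⇔ (λ ()) (λ lt → contradiction lt (m+n≮n 1 h))
  head true  false = mk⇔ (λ ()) (λ lt → contradiction lt (m+n≮n 1 h))
agree⇔flipAt-farther (suc k) (a ∷ ys) (c ∷ zs) =
  ⇔-trans (agree⇔flipAt-farther k ys zs) (mk⇔ (+-monoʳ-< (diff a c)) (+-cancelˡ-< (diff a c) _ _))

MapsCoord : Aut N → Fin N → Fin N → Bool → Set
MapsCoord G p j γ = ∀ x → lookup (fun G x) j ≡ lookup x p xor γ

≡⇔≡false⇒≡xor : ∀ a b c → (a ≡ c ⇔ b ≡ false) → a ≡ b xor c
≡⇔≡false⇒≡xor a false c a≡c⇔ = from a≡c⇔ refl
≡⇔≡false⇒≡xor a true  c a≡c⇔ = ¬-not (λ a≡c → contradiction (to a≡c⇔ a≡c) λ ())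

-- The image of the edge from 0 in direction p is an edge of direction j; distances to its
-- two ends then decide coordinate j of every image.
mapsCoord-from : (G : Aut N) (p : Fin N) → ∃₂ λ j γ → MapsCoord G p j γ
mapsCoord-from {N} G p = j , lookup (fun G z) j , λ x → ≡⇔≡false⇒≡xor _ _ _ (agree⇔ x)
  where
  z = replicate N false
  edge = hamming≡1⇒flipAt (fun G z) (fun G (flipAt p z))
                          (trans (Aut-isometry G z (flipAt p z)) (hamming-flipAt p z))
  j = proj₁ edge
  agree⇔ : ∀ x → lookup (fun G x) j ≡ lookup (fun G z) j ⇔ lookup x p ≡ false
  agree⇔ x = ⇔-trans (agree⇔flipAt-farther j (fun G x) (fun G z))
    (subst₂ (λ u v → u < v ⇔ lookup x p ≡ false) (sym (Aut-isometry G x z)) (sym far)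
      (subst (λ c → hamming x z < hamming x (flipAt p z) ⇔ lookup x p ≡ c) (lookup-replicate p false)
             (⇔-sym (agree⇔flipAt-farther p x z))))
    where
    far : hamming (fun G x) (flipAt j (fun G z)) ≡ hamming x (flipAt p z)
    far = trans (cong (hamming (fun G x)) (sym (proj₂ edge))) (Aut-isometry G x (flipAt p z))

xor-transpose : ∀ {a} b c → a ≡ b xor c → b ≡ a xor c
xor-transpose false false refl = refl
xor-transpose false true  refl = refl
xor-transpose true  false refl = refl
xor-transpose true  true  refl = refl

mapsCoord-to : (G : Aut N) (j : Fin N) → ∃₂ λ p γ → MapsCoord G p j γ
mapsCoord-to G j with p , γ , P ← mapsCoord-from (G ⁻¹ᴬ) j =
  p , γ , λ y → xor-transpose _ γ (subst (λ v → lookup v p ≡ _) (inv-l G y) (P (fun G y)))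

xor-xor-cancelˡ : ∀ a b c → (a xor b) xor (a xor c) ≡ b xor c
xor-xor-cancelˡ false b     c     = refl
xor-xor-cancelˡ true  false false = refl
xor-xor-cancelˡ true  false true  = refl
xor-xor-cancelˡ true  true  false = refl
xor-xor-cancelˡ true  true  true  = refl

mapsCoord-injective : ∀ (G : Aut N) {p j j′ γ γ′} → MapsCoord G p j γ → MapsCoord G p j′ γ′ → j ≡ j′
mapsCoord-injective {N} G {p} {j} {j′} {γ} {γ′} P P′ with j ≟ᶠ j′
... | yes j≡j′ = j≡j′
... | no  j≢j′ = contradiction (trans (sym flipped) (trans (parity (flipAt j z)) (trans (sym (parity z)) unflipped))) λ ()
  where
  z = replicate N false
  parity : ∀ w → lookup w j xor lookup w j′ ≡ γ xor γ′
  parity w = begin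
    lookup w j xor lookup w j′                                 ≡⟨ cong (λ v → lookup v j xor lookup v j′) (inv-r G w) ⟨
    lookup (fun G (inv G w)) j xor lookup (fun G (inv G w)) j′ ≡⟨ cong₂ _xor_ (P (inv G w)) (P′ (inv G w)) ⟩
    (lookup (inv G w) p xor γ) xor (lookup (inv G w) p xor γ′) ≡⟨ xor-xor-cancelˡ (lookup (inv G w) p) γ γ′ ⟩
    γ xor γ′                                                   ∎
    where open ≡-Reasoning
  unflipped : lookup z j xor lookup z j′ ≡ false
  unflipped = cong₂ _xor_ (lookup-replicate j false) (lookup-replicate j′ false)
  flipped : lookup (flipAt j z) j xor lookup (flipAt j z) j′ ≡ true
  flipped = cong₂ _xor_ (trans (lookup∘updateAt j z) (cong not (lookup-replicate j false)))
                        (trans (lookup∘updateAt′ j′ j (j≢j′ ∘ sym) z) (lookup-replicate j′ false))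

-- Initial segments

2^n≤2^[1+n] : ∀ n → 2 ^ n ≤ 2 ^ suc n
2^n≤2^[1+n] n = m≤m+n (2 ^ n) (2 ^ n + 0)

val<2^N : (x : V N) → val x < 2 ^ N
val<2^N             []           = s≤s z≤n
val<2^N {N = suc N} (false ∷ xs) = ≤-trans (val<2^N xs) (2^n≤2^[1+n] N)
val<2^N {N = suc N} (true ∷ xs)  = +-monoʳ-< (2 ^ N) (≤-trans (val<2^N xs) (m≤m+n (2 ^ N) 0))

val-replicate-false : ∀ N → val (replicate N false) ≡ 0
val-replicate-false zero    = refl
val-replicate-false (suc N) = val-replicate-false N

head≡false⇔val< : (x : V (suc n)) → lookup x zero ≡ false ⇔ val x < 2 ^ n
head≡false⇔val< (false ∷ r) = mk⇔ (λ _ → val<2^N r) (λ _ → refl)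
head≡false⇔val< (true ∷ r)  = mk⇔ (λ ()) (λ lt → contradiction lt (m+n≮m _ (val r)))

first-two≡false⇔val< : (x : V (suc (suc n))) →
  (lookup x zero ≡ false × lookup x (suc zero) ≡ false) ⇔ val x < 2 ^ n
first-two≡false⇔val<     (false ∷ false ∷ r) = mk⇔ (λ _ → val<2^N r) (λ _ → refl , refl)
first-two≡false⇔val<     (false ∷ true ∷ r)  = mk⇔ (λ { (_ , ()) }) (λ lt → contradiction lt (m+n≮m _ (val r)))
first-two≡false⇔val< {n} (true ∷ r)          = mk⇔ (λ { (() , _) })
  (λ lt → contradiction (from (head≡false⇔val< (true ∷ r)) (<-≤-trans lt (2^n≤2^[1+n] n))) λ ())

complement : V N → V N
complement = replicate _ true ⊕_

suc[val+val-complement] : (x : V N) → suc (val x + val (complement x)) ≡ 2 ^ N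
suc[val+val-complement]             []       = refl
suc[val+val-complement] {N = suc N} (b ∷ xs) = begin
  suc (val (b ∷ xs) + val (complement (b ∷ xs))) ≡⟨ cong suc (leading b) ⟩
  suc (2 ^ N + (val xs + val (complement xs)))   ≡⟨ +-suc (2 ^ N) _ ⟨
  2 ^ N + suc (val xs + val (complement xs))     ≡⟨ cong (2 ^ N +_) (suc[val+val-complement] xs) ⟩
  2 ^ N + 2 ^ N                                  ≡⟨ cong (2 ^ N +_) (+-identityʳ (2 ^ N)) ⟨
  2 ^ suc N                                      ∎
  where
  open ≡-Reasoning
  leading : ∀ b → val (b ∷ xs) + val (complement (b ∷ xs)) ≡ 2 ^ N + (val xs + val (complement xs))
  leading false = x∙yz≈y∙xz (val xs) (2 ^ N) _
  leading true  = +-assoc (2 ^ N) (val xs) _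

complementary-<⇔≤ : ∀ {u v} → suc (u + v) ≡ t + t′ → v < t′ ⇔ t ≤ u
complementary-<⇔≤ {t} {t′} {u} {v} e = mk⇔
  (λ v<t′ → +-cancelʳ-≤ v t u (≤-pred (begin
     suc (t + v) ≡⟨ +-suc t v ⟨
     t + suc v   ≤⟨ +-monoʳ-≤ t v<t′ ⟩
     t + t′      ≡⟨ e ⟨
     suc (u + v) ∎)))
  (λ t≤u → +-cancelˡ-≤ t (suc v) t′ (begin
     t + suc v   ≡⟨ +-suc t v ⟩
     suc (t + v) ≤⟨ s≤s (+-monoˡ-≤ v t≤u) ⟩
     suc (u + v) ≡⟨ e ⟩
     t + t′      ∎))
  where open ≤-Reasoning

complementTail : Aut (suc n)
complementTail = translation (false ∷ replicate _ true)

complementTail-<⇔ : (x : V (suc n)) → k + k′ ≡ 2 ^ n →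
  val (fun complementTail x) < k′ ⇔ (lookup x zero ≡ false × k ≤ val x)
complementTail-<⇔ (false ∷ r) e = mk⇔ (λ lt → refl , to ⇔k≤ lt) (λ (_ , k≤r) → from ⇔k≤ k≤r)
  where ⇔k≤ = complementary-<⇔≤ (trans (suc[val+val-complement] r) (sym e))
complementTail-<⇔ {k = k} {k′} (true ∷ r) e = mk⇔
  (λ lt → contradiction (<-≤-trans lt (≤-trans (m≤n+m k′ k) (≤-reflexive e))) (m+n≮m _ _))
  (λ { (() , _) })

xor≡false⇔≡ : ∀ a b → a xor b ≡ false ⇔ a ≡ b
xor≡false⇔≡ false false = mk⇔ (λ _ → refl) (λ _ → refl)
xor≡false⇔≡ false true  = mk⇔ (λ ()) (λ ())
xor≡false⇔≡ true  false = mk⇔ (λ ()) (λ ())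
xor≡false⇔≡ true  true  = mk⇔ (λ _ → refl) (λ _ → refl)

-- Faces and their complements in half cubes

InFace : Aut N → ℕ → Fin N → Bool → Set
InFace φ k p β = ∀ y → val (fun φ y) < k → lookup y p ≡ β

mapsCoord⇒inFace : ∀ (φ : Aut N) {j k} → MapsCoord φ p j β → (∀ x → val x < k → lookup x j ≡ false) → InFace φ k p β
mapsCoord⇒inFace φ P small y lt = to (xor≡false⇔≡ _ _) (trans (sym (P y)) (small (fun φ y) lt))

-- For k > 0, ψ is φ followed by the swap of coordinate 0 with the image j of p, which fixes I_k pointwise.
anchor : (φ : Aut (suc n)) → k ≤ 2 ^ n → InFace φ k p β →
  ∃[ ψ ] (∀ y → val (fun ψ y) < k ⇔ val (fun φ y) < k) × MapsCoord ψ p zero β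
anchor {n} {zero} {p = p} {β} φ _ _ =
  translation (β ∷ replicate n false) ∘ᴬ swap p , (λ _ → mk⇔ (λ ()) (λ ())) , λ y →
    trans (lookup-zipWith _xor_ zero (β ∷ replicate n false) (swap₀ p y))
          (trans (cong (β xor_) (lookup-swap₀ p y)) (xor-comm β _))
anchor {n} {suc k} {p = p} {β} φ k≤ inFace = swap j ∘ᴬ φ , (λ y → preserved (fun φ y)) , maps
  where
  j = proj₁ (mapsCoord-from φ p)
  γ = proj₁ (proj₂ (mapsCoord-from φ p))
  P = proj₂ (proj₂ (mapsCoord-from φ p))
  coordinate-j : ∀ x → val x < suc k → lookup x j ≡ β xor γ
  coordinate-j x lt = begin
    lookup x j                  ≡⟨ cong (λ w → lookup w j) (inv-r φ x) ⟨
    lookup (fun φ (inv φ x)) j  ≡⟨ P (inv φ x) ⟩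
    lookup (inv φ x) p xor γ    ≡⟨ cong (_xor γ) (inFace (inv φ x) (subst (λ w → val w < suc k) (sym (inv-r φ x)) lt)) ⟩
    β xor γ                     ∎
    where open ≡-Reasoning
  β⊕γ≡false : β xor γ ≡ false
  β⊕γ≡false = trans (sym (coordinate-j (replicate (suc n) false)
                                      (subst (_< suc k) (sym (val-replicate-false (suc n))) (s≤s z≤n))))
                    (lookup-replicate j false)
  fixed : ∀ x → val x < suc k → swap₀ j x ≡ x
  fixed x lt = swap₀-fixes j x (trans (from (head≡false⇔val< x) (<-≤-trans lt k≤))
                                      (sym (trans (coordinate-j x lt) β⊕γ≡false)))
  preserved : ∀ x → val (swap₀ j x) < suc k ⇔ val x < suc k
  preserved x = mk⇔ (λ lt → subst (λ w → val w < suc k) (trans (sym (fixed _ lt)) (swap₀-involutive j x)) lt)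
                    (λ lt → subst (λ w → val w < suc k) (sym (fixed x lt)) lt)
  maps : MapsCoord (swap j ∘ᴬ φ) p zero β
  maps y = trans (lookup-swap₀ j (fun φ y))
                 (trans (P y) (cong (lookup y p xor_) (sym (to (xor≡false⇔≡ β γ) β⊕γ≡false))))

face-complement : (φ : Aut (suc n)) → k ≤ 2 ^ n → k + k′ ≡ 2 ^ n → InFace φ k p β →
  ∃[ χ ] ∀ y → val (fun χ y) < k′ ⇔ (lookup y p ≡ β × val (fun φ y) ≮ k)
face-complement {p = p} {β} φ k≤ e inFace with ψ , same , maps ← anchor φ k≤ inFace =
  complementTail ∘ᴬ ψ , λ y → ⇔-trans (complementTail-<⇔ (fun ψ y) e) (leading y ×-⇔ outside y)
  where
  leading : ∀ y → lookup (fun ψ y) zero ≡ false ⇔ lookup y p ≡ β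
  leading y = subst (λ c → c ≡ false ⇔ lookup y p ≡ β) (sym (maps y)) (xor≡false⇔≡ _ _)
  outside : ∀ y → _ ≤ val (fun ψ y) ⇔ val (fun φ y) ≮ _
  outside y = mk⇔ (λ k≤ψy lt → <⇒≱ (from (same y) lt) k≤ψy) (λ φy≮ → ≮⇒≥ (φy≮ ∘ to (same y)))

-- Covers by images of initial segments

Covers : Aut N → Aut N → ℕ → ℕ → ℕ → Set
Covers φ₁ φ₂ a b t = ∀ y → (val (fun φ₁ y) < a ⊎ val (fun φ₂ y) < b) ⇔ val y < t

Cover : ℕ → ℕ → ℕ → ℕ → Set
Cover N a b t = ∃₂ λ (φ₁ φ₂ : Aut N) → Covers φ₁ φ₂ a b t

image⇔ : (g : Aut N) (y : V N) → (∃[ x ] InI k x × fun g x ≡ y) ⇔ val (inv g y) < k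
image⇔ {k = k} g y = mk⇔ (λ { (x , lt , refl) → subst (λ w → val w < k) (sym (inv-l g x)) lt })
                         (λ lt → inv g y , lt , inv-r g y)

Fit⇔Cover : Fit N a b ⇔ Cover N a b (a + b)
Fit⇔Cover = mk⇔
  (λ (g₁ , g₂ , U) → g₁ ⁻¹ᴬ , g₂ ⁻¹ᴬ , λ y → ⇔-trans (⇔-sym (image⇔ g₁ y ⊎-⇔ image⇔ g₂ y)) (U y))
  (λ (φ₁ , φ₂ , U) → φ₁ ⁻¹ᴬ , φ₂ ⁻¹ᴬ , λ y → ⇔-trans (image⇔ (φ₁ ⁻¹ᴬ) y ⊎-⇔ image⇔ (φ₂ ⁻¹ᴬ) y) (U y))

covers-swap : (φ₁ φ₂ : Aut N) → Covers φ₁ φ₂ a b t → Covers φ₂ φ₁ b a t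
covers-swap φ₁ φ₂ U y = ⇔-trans (mk⇔ ⊎-swap ⊎-swap) (U y)

Cover-swap : Cover N a b t → Cover N b a t
Cover-swap (φ₁ , φ₂ , U) = φ₂ , φ₁ , covers-swap φ₁ φ₂ U

-- Counting vertices

bits : (N : ℕ) → ℕ → V N
bits zero    _ = []
bits (suc N) k with k <? 2 ^ N
... | yes _ = false ∷ bits N k
... | no  _ = true ∷ bits N (k ∸ 2 ^ N)

val-bits : ∀ N {k} → k < 2 ^ N → val (bits N k) ≡ k
val-bits zero    {zero}  _  = refl
val-bits zero    {suc _} (s≤s ())
val-bits (suc N) {k}     k< with k <? 2 ^ N
... | yes k<half = val-bits N k<half
... | no  k≮half = trans (cong (2 ^ N +_) (val-bits N rest<)) (m+[n∸m]≡n (≮⇒≥ k≮half))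
  where
  rest< : k ∸ 2 ^ N < 2 ^ N
  rest< = subst (k ∸ 2 ^ N <_) (m+n∸m≡n (2 ^ N) (2 ^ N))
            (∸-monoˡ-< (subst (k <_) (cong (2 ^ N +_) (+-identityʳ (2 ^ N))) k<) (≮⇒≥ k≮half))

bits-val : (x : V N) → bits N (val x) ≡ x
bits-val                 []           = refl
bits-val {N = suc N} (false ∷ xs) with val xs <? 2 ^ N
... | yes _   = cong (false ∷_) (bits-val xs)
... | no  xs≮ = contradiction (val<2^N xs) xs≮
bits-val {N = suc N} (true ∷ xs)  with 2 ^ N + val xs <? 2 ^ N
... | yes lt = contradiction lt (m+n≮m (2 ^ N) (val xs))
... | no  _  = cong (true ∷_) (trans (cong (bits N) (m+n∸m≡n (2 ^ N) (val xs))) (bits-val xs))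

toFin : V N → Fin (2 ^ N)
toFin x = fromℕ< (val<2^N x)

fromFin : Fin (2 ^ N) → V N
fromFin {N} i = bits N (toℕ i)

fromFin-toFin : (x : V N) → fromFin (toFin x) ≡ x
fromFin-toFin {N} x = trans (cong (bits N) (toℕ-fromℕ< (val<2^N x))) (bits-val x)

toFin-fromFin : (i : Fin (2 ^ N)) → toFin (fromFin {N} i) ≡ i
toFin-fromFin {N} i = toℕ-injective (trans (toℕ-fromℕ< _) (val-bits N (toℕ<n i)))

indicator : Bool → ℕ
indicator b = if b then 1 else 0

count : (V N → Bool) → ℕ
count {N} P = ∑[ i < 2 ^ N ] indicator (P (fromFin i))

count-∘-Aut : (φ : Aut N) (P : V N → Bool) → count (P ∘ fun φ) ≡ count P
count-∘-Aut {N} φ P = sym (trans (sum-permute (indicator ∘ P ∘ fromFin) π)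
                                 (sum-cong-≗ (cong (indicator ∘ P) ∘ fromFin-toFin ∘ fun φ ∘ fromFin)))
  where
  π : Permutation (2 ^ N) (2 ^ N)
  π = permutation (toFin ∘ fun φ ∘ fromFin) (toFin ∘ inv φ ∘ fromFin)
        (λ i → trans (cong (toFin ∘ fun φ) (fromFin-toFin (inv φ (fromFin i))))
                     (trans (cong toFin (inv-r φ (fromFin i))) (toFin-fromFin {N} i)))
        (λ i → trans (cong (toFin ∘ inv φ) (fromFin-toFin (fun φ (fromFin i))))
                     (trans (cong toFin (inv-l φ (fromFin i))) (toFin-fromFin {N} i)))

count-I : k ≤ 2 ^ N → count {N} (λ y → does (val y <? k)) ≡ k
count-I {k} {N} k≤ = trans (sum-cong-≗ value) (initial k≤)
  where
  value : ∀ (i : Fin (2 ^ N)) → indicator (does (val (fromFin {N} i) <? k)) ≡ indicator (does (toℕ i <? k))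
  value i = cong (λ v → indicator (does (v <? k))) (val-bits N (toℕ<n i))
  initial : ∀ {M k} → k ≤ M → ∑[ i < M ] indicator (does (toℕ i <? k)) ≡ k
  initial {zero}  {zero}  _         = refl
  initial {suc M} {zero}  _         = initial {M} z≤n
  initial {suc M} {suc k} (s≤s k≤) = cong suc (initial k≤)

count-∨+∧ : (P Q : V N → Bool) → count P + count Q ≡ count (λ y → P y ∨ Q y) + count (λ y → P y ∧ Q y)
count-∨+∧ {N} P Q = begin
  count P + count Q                                  ≡⟨ ∑-distrib-+ (indicator ∘ P ∘ fromFin) (indicator ∘ Q ∘ fromFin) ⟨
  ∑[ i < 2 ^ N ] (indicator (P (fromFin i)) + indicator (Q (fromFin i)))
    ≡⟨ sum-cong-≗ (λ i → pointwise (P (fromFin i)) (Q (fromFin i))) ⟩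
  ∑[ i < 2 ^ N ] (indicator (P (fromFin i) ∨ Q (fromFin i)) + indicator (P (fromFin i) ∧ Q (fromFin i)))
    ≡⟨ ∑-distrib-+ (λ i → indicator (P (fromFin i) ∨ Q (fromFin i))) (λ i → indicator (P (fromFin i) ∧ Q (fromFin i))) ⟩
  count (λ y → P y ∨ Q y) + count (λ y → P y ∧ Q y) ∎
  where
  open ≡-Reasoning
  pointwise : ∀ a b → indicator a + indicator b ≡ indicator (a ∨ b) + indicator (a ∧ b)
  pointwise false b     = sym (+-identityʳ _)
  pointwise true  false = refl
  pointwise true  true  = refl

count≡0 : (P : V N → Bool) → count P ≡ 0 → ∀ y → P y ≡ false
count≡0 {N} P total≡0 y = lemma (P y) (subst (λ v → indicator (P v) ≡ 0) (fromFin-toFin y)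
                                              (term≡0 (indicator ∘ P ∘ fromFin) total≡0 (toFin y)))
  where
  term≡0 : ∀ {M} (f : Fin M → ℕ) → ∑[ i < M ] f i ≡ 0 → ∀ i → f i ≡ 0
  term≡0 f e zero    = m+n≡0⇒m≡0 (f zero) e
  term≡0 f e (suc i) = term≡0 (f ∘ suc) (m+n≡0⇒n≡0 (f zero) e) i
  lemma : ∀ b → indicator b ≡ 0 → b ≡ false
  lemma false _ = refl

-- Both preimages have their full sizes a and b, which add up to the size of I_{a+b}.
covers-disjoint : (φ₁ φ₂ : Aut N) → a + b ≤ 2 ^ N → Covers φ₁ φ₂ a b (a + b) →
  ∀ y → val (fun φ₁ y) < a → val (fun φ₂ y) ≮ b
covers-disjoint {N} {a} {b} φ₁ φ₂ a+b≤ U y in₁ in₂ =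
  contradiction (trans (sym (cong₂ _∧_ (dec-true (_ <? a) in₁) (dec-true (_ <? b) in₂)))
                       (count≡0 (λ y → A y ∧ B y) overlap≡0 y)) λ ()
  where
  A B : V N → Bool
  A y = does (val (fun φ₁ y) <? a)
  B y = does (val (fun φ₂ y) <? b)
  count-A : count A ≡ a
  count-A = trans (count-∘-Aut φ₁ (λ y → does (val y <? a))) (count-I {N = N} (≤-trans (m≤m+n a b) a+b≤))
  count-B : count B ≡ b
  count-B = trans (count-∘-Aut φ₂ (λ y → does (val y <? b))) (count-I {N = N} (≤-trans (m≤n+m b a) a+b≤))
  count-A∨B : count (λ y → A y ∨ B y) ≡ a + b
  count-A∨B = trans (sum-cong-≗ λ i → cong indicator (covered (fromFin i))) (count-I {N = N} a+b≤)
    where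
    covered : ∀ y → A y ∨ B y ≡ does (val y <? a + b)
    covered y = does-⇔ (U y) ((val (fun φ₁ y) <? a) ⊎-dec (val (fun φ₂ y) <? b)) (val y <? a + b)
  overlap≡0 : count (λ y → A y ∧ B y) ≡ 0
  overlap≡0 = +-cancelˡ-≡ (a + b) _ 0 (begin
    (a + b) + count (λ y → A y ∧ B y)                 ≡⟨ cong (_+ count (λ y → A y ∧ B y)) count-A∨B ⟨
    count (λ y → A y ∨ B y) + count (λ y → A y ∧ B y) ≡⟨ count-∨+∧ A B ⟨
    count A + count B                                 ≡⟨ cong₂ _+_ count-A count-B ⟩
    a + b                                             ≡⟨ +-identityʳ (a + b) ⟨
    (a + b) + 0                                       ∎)
    where open ≡-Reasoning

-- Complementing a cover

¬-⇔ : ∀ {A B : Set} → A ⇔ B → (¬ A) ⇔ (¬ B)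
¬-⇔ A⇔B = mk⇔ (λ ¬A → ¬A ∘ from A⇔B) (λ ¬B → ¬B ∘ to A⇔B)

≮⇔≥ : ∀ {u v} → u ≮ v ⇔ v ≤ u
≮⇔≥ = mk⇔ ≮⇒≥ ≤⇒≯

balance : ∀ {x y u v} → x + y ≡ u + v → u ≤ x → y ≤ v
balance {x} {y} {u} {v} e u≤x = +-cancelˡ-≤ u y v (≤-trans (+-monoˡ-≤ y u≤x) (≤-reflexive e))

-- Pointwise form of (F ∖ A) ∪ (∁F ∖ B) = ∁(A ∪ B) for A ⊆ F, B ⊆ ∁F, with F the face c = β.
opposite-faces-pointwise : ∀ {A B : Set} {c β} → (A → c ≡ β) → (B → c ≡ not β) →
  ((c ≡ β × ¬ A) ⊎ (c ≡ not β × ¬ B)) ⇔ (¬ (A ⊎ B))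
opposite-faces-pointwise {A = A} {B} {c} {β} A⇒ B⇒ = mk⇔ to′ from′
  where
  to′ : (c ≡ β × ¬ A) ⊎ (c ≡ not β × ¬ B) → ¬ (A ⊎ B)
  to′ (inj₁ (c≡β , ¬A))  = [ ¬A , not-¬ c≡β ∘ B⇒ ]′
  to′ (inj₂ (c≡¬β , ¬B)) = [ (λ a → not-¬ (A⇒ a) c≡¬β) , ¬B ]′
  from′ : ¬ (A ⊎ B) → (c ≡ β × ¬ A) ⊎ (c ≡ not β × ¬ B)
  from′ ¬A⊎B with c ≟ᵇ β
  ... | yes c≡β = inj₁ (c≡β , ¬A⊎B ∘ inj₁)
  ... | no  c≢β = inj₂ (¬-not c≢β , ¬A⊎B ∘ inj₂)

-- Pointwise form of (F₁ ∖ A) ∪ (F₀ ∖ B) = F₁ ∪ (F₀ ∖ (A ∪ B)) for disjoint A, B with A ⊆ F₀ ∩ F₁,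
-- where F_i is the face c_i = false.
second-face-pointwise : ∀ {A B L : Set} {c₀ c₁ : Bool} → Dec A → (A → c₀ ≡ false) → (A → c₁ ≡ false) →
  (A → ¬ B) → (A ⊎ B) ⇔ L → ((c₁ ≡ false × ¬ A) ⊎ (c₀ ≡ false × ¬ B)) ⇔ (c₁ ≡ false ⊎ (c₀ ≡ false × ¬ L))
second-face-pointwise {A = A} {B} {L} {c₀} {c₁} A? A⇒c₀ A⇒c₁ disjoint A⊎B⇔L = mk⇔ to′ from′
  where
  to′ : (c₁ ≡ false × ¬ A) ⊎ (c₀ ≡ false × ¬ B) → c₁ ≡ false ⊎ (c₀ ≡ false × ¬ L)
  to′ (inj₁ (c₁≡f , _)) = inj₁ c₁≡f
  to′ (inj₂ (c₀≡f , ¬B)) with c₁ ≟ᵇ false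
  ... | yes c₁≡f = inj₁ c₁≡f
  ... | no  c₁≢f = inj₂ (c₀≡f , [ c₁≢f ∘ A⇒c₁ , ¬B ]′ ∘ from A⊎B⇔L)
  from′ : c₁ ≡ false ⊎ (c₀ ≡ false × ¬ L) → (c₁ ≡ false × ¬ A) ⊎ (c₀ ≡ false × ¬ B)
  from′ (inj₁ c₁≡f) = [ (λ a → inj₂ (A⇒c₀ a , disjoint a)) , (λ ¬a → inj₁ (c₁≡f , ¬a)) ]′ (toSum A?)
  from′ (inj₂ (c₀≡f , ¬L)) = inj₂ (c₀≡f , ¬L ∘ to A⊎B⇔L ∘ inj₂)

-- Pointwise form of F₀ ∖ g(∁F₀ ∩ L) = g(F₀ ∖ A) ∪ (F₀ ∖ g B) for disjoint A, B with L = A ∪ B ⊇ F₀,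
-- A ⊆ F₀ and g B ⊆ F₀, where x = g w and w₀, x₀ are the leading coordinates of w and x.
leading-face-pointwise : ∀ {A B L : Set} {w₀ x₀ : Bool} → Dec B → (A → w₀ ≡ false) → (B → x₀ ≡ false) →
  (A → ¬ B) → (A ⊎ B) ⇔ L → (w₀ ≡ false → L) →
  (x₀ ≡ false × ¬ (w₀ ≡ true × L)) ⇔ ((w₀ ≡ false × ¬ A) ⊎ (x₀ ≡ false × ¬ B))
leading-face-pointwise {A = A} {B} {L} {w₀} {x₀} B? A⇒w₀ B⇒x₀ disjoint A⊎B⇔L w₀⇒L = mk⇔ to′ from′
  where
  to′ : x₀ ≡ false × ¬ (w₀ ≡ true × L) → (w₀ ≡ false × ¬ A) ⊎ (x₀ ≡ false × ¬ B)
  to′ (x₀≡f , ¬w₀L) =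
    [ (λ b → inj₁ (¬-not (λ w₀≡t → ¬w₀L (w₀≡t , to A⊎B⇔L (inj₂ b))) , λ a → disjoint a b)) ,
      (λ ¬b → inj₂ (x₀≡f , ¬b)) ]′ (toSum B?)
  from′ : (w₀ ≡ false × ¬ A) ⊎ (x₀ ≡ false × ¬ B) → x₀ ≡ false × ¬ (w₀ ≡ true × L)
  from′ (inj₁ (w₀≡f , ¬A)) =
    [ ⊥-elim ∘ ¬A , B⇒x₀ ]′ (from A⊎B⇔L (w₀⇒L w₀≡f)) , λ (w₀≡t , _) → not-¬ w₀≡t w₀≡f
  from′ (inj₂ (x₀≡f , ¬B)) =
    x₀≡f , λ (w₀≡t , l) → [ (λ a → not-¬ w₀≡t (A⇒w₀ a)) , ¬B ]′ (from A⊎B⇔L l)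

cover-complement-opposite-faces : (φ₁ φ₂ : Aut (suc n)) →
  k₁ ≤ 2 ^ n → k₂ ≤ 2 ^ n → k₁ + k₁′ ≡ 2 ^ n → k₂ + k₂′ ≡ 2 ^ n → t + t′ ≡ 2 ^ suc n →
  Covers φ₁ φ₂ k₁ k₂ t → InFace φ₁ k₁ p β → InFace φ₂ k₂ p (not β) → Cover (suc n) k₁′ k₂′ t′
cover-complement-opposite-faces {n} {t = t} {t′} φ₁ φ₂ k₁≤ k₂≤ e₁ e₂ e U F₁ F₂
  with χ₁ , C₁ ← face-complement φ₁ k₁≤ e₁ F₁ | χ₂ , C₂ ← face-complement φ₂ k₂≤ e₂ F₂ =
  χ₁ ∘ᴬ translation ones , χ₂ ∘ᴬ translation ones , λ y →
    ⇔-trans (C₁ (complement y) ⊎-⇔ C₂ (complement y))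
   (⇔-trans (opposite-faces-pointwise (F₁ (complement y)) (F₂ (complement y)))
   (⇔-trans (¬-⇔ (U (complement y)))
   (⇔-trans ≮⇔≥ (⇔-sym (complementary-<⇔≤ (total y))))))
  where
  ones = replicate (suc n) true
  total : ∀ y → suc (val (complement y) + val y) ≡ t + t′
  total y = trans (cong suc (+-comm _ (val y))) (trans (suc[val+val-complement] y) (sym e))

twist : Aut (suc (suc n))
twist = swap (suc zero) ∘ᴬ translation (false ∷ false ∷ replicate _ true)

-- I_{s′} is the complement of I_s; the twist turns it into F₁ ∪ (F₀ ∖ I_s), F_i being the face x_i = false.
twist-<⇔ : (y : V (suc (suc n))) → 2 ^ n ≤ s → s ≤ 2 ^ suc n → s + s′ ≡ 2 ^ suc (suc n) →
  val y < s′ ⇔ (lookup (fun twist y) (suc zero) ≡ false ⊎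
                (lookup (fun twist y) zero ≡ false × val (fun twist y) ≮ s))
twist-<⇔ (false ∷ c ∷ r) _ s≤H e =
  mk⇔ (λ _ → inj₁ refl) (λ _ → <-≤-trans (val<2^N (c ∷ r)) (≤-trans (m≤m+n _ 0) (balance (sym e) s≤H)))
twist-<⇔ {n} {s′ = s′} (true ∷ true ∷ r) h≤s _ e =
  mk⇔ (λ lt → contradiction (≤-trans s′≤ (+-monoʳ-≤ (2 ^ suc n) (m≤m+n (2 ^ n) (val r)))) (<⇒≱ lt))
      (λ { (inj₁ ()) ; (inj₂ (() , _)) })
  where
  h = 2 ^ n
  s′≤ : s′ ≤ 2 ^ suc n + h
  s′≤ = balance (trans e (solve 1 (λ h → (h :+ (h :+ con 0)) :+ ((h :+ (h :+ con 0)) :+ con 0)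
                                       := h :+ ((h :+ (h :+ con 0)) :+ h)) refl h)) h≤s
twist-<⇔ {n} (true ∷ false ∷ r) _ _ e =
  ⇔-trans (complementary-<⇔≤ (trans total (sym e)))
    (⇔-trans (⇔-sym ≮⇔≥) (mk⇔ (λ ≮s → inj₂ (refl , ≮s)) λ { (inj₁ ()) ; (inj₂ (_ , ≮s)) → ≮s }))
  where
  h = 2 ^ n
  v = val r
  c = val (complement r)
  total : suc ((h + c) + (2 ^ suc n + v)) ≡ 2 ^ suc (suc n)
  total = begin
    suc ((h + c) + ((h + (h + 0)) + v))       ≡⟨ solve 3 (λ h v c → con 1 :+ ((h :+ c) :+ ((h :+ (h :+ con 0)) :+ v))
                                                      := (h :+ (h :+ con 0)) :+ ((h :+ ((con 1 :+ (v :+ c)) :+ con 0)) :+ con 0))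
                                                 refl h v c ⟩
    (h + (h + 0)) + ((h + (suc (v + c) + 0)) + 0) ≡⟨ cong (λ w → (h + (h + 0)) + ((h + (w + 0)) + 0)) (suc[val+val-complement] r) ⟩
    (h + (h + 0)) + ((h + (h + 0)) + 0)       ∎
    where open ≡-Reasoning

cover-complement-second-face : ∀ {a′ b′} (φ₁ φ₂ : Aut (suc (suc n))) →
  a ≤ 2 ^ suc n → b ≤ 2 ^ suc n → a + a′ ≡ 2 ^ suc n → b + b′ ≡ 2 ^ suc n →
  a + b ≡ t → 2 ^ n ≤ t → t ≤ 2 ^ suc n → t + s′ ≡ 2 ^ suc (suc n) →
  Covers φ₁ φ₂ a b t → InFace φ₁ a (suc zero) false → Cover (suc (suc n)) a′ b′ s′
cover-complement-second-face {n} {a} {b} φ₁ φ₂ a≤ b≤ ea eb refl h≤t t≤H e U F₁ =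
  let χ₁ , C₁ = face-complement φ₁ a≤ ea F₁
      χ₂ , C₂ = face-complement φ₂ b≤ eb (λ x → leading≡false x ∘ inj₂)
  in χ₁ ∘ᴬ twist , χ₂ ∘ᴬ twist , λ y →
       ⇔-trans (C₁ (fun twist y) ⊎-⇔ C₂ (fun twist y))
      (⇔-trans (pointwise (fun twist y))
               (⇔-sym (twist-<⇔ y h≤t t≤H e)))
  where
  leading≡false : (x : V (suc (suc n))) → val (fun φ₁ x) < a ⊎ val (fun φ₂ x) < b → lookup x zero ≡ false
  leading≡false x A⊎B = from (head≡false⇔val< x) (<-≤-trans (to (U x) A⊎B) t≤H)
  pointwise : (x : V (suc (suc n))) →
    ((lookup x (suc zero) ≡ false × val (fun φ₁ x) ≮ a) ⊎ (lookup x zero ≡ false × val (fun φ₂ x) ≮ b)) ⇔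
    (lookup x (suc zero) ≡ false ⊎ (lookup x zero ≡ false × val x ≮ a + b))
  pointwise x = second-face-pointwise (_ <? a) (leading≡false x ∘ inj₁) (F₁ x)
    (covers-disjoint φ₁ φ₂ (≤-trans t≤H (2^n≤2^[1+n] (suc n))) U x) (U x)

flipLeading : Aut (suc n)
flipLeading = translation (true ∷ replicate _ false)

flipLeading-<⇔ : (w : V (suc n)) → d ≤ 2 ^ n →
  val (fun flipLeading w) < d ⇔ (lookup w zero ≡ true × val w < 2 ^ n + d)
flipLeading-<⇔ {n} {d} (true ∷ r) _ =
  subst (λ u → val u < d ⇔ (true ≡ true × 2 ^ n + val r < 2 ^ n + d)) (sym (⊕-identityˡ r))
        (mk⇔ (λ lt → refl , +-monoʳ-< (2 ^ n) lt) (λ (_ , lt) → +-cancelˡ-< (2 ^ n) _ _ lt))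
flipLeading-<⇔ (false ∷ r) d≤ = mk⇔ (λ lt → contradiction (<-≤-trans lt d≤) (m+n≮m _ _)) (λ { (() , _) })

-- The part of I_{a′+b′} off the face F₀ lies in φ₂⁻¹(I_{b′}), so flipLeading ∘ φ₂⁻¹ pulls I_d back into F₀,
-- and face-complement applies.
overflow-complement : ∀ {a′ b′} (φ₁ φ₂ : Aut (suc n)) → b′ ≤ 2 ^ n → a′ + b′ ≡ 2 ^ n + d → d + s ≡ 2 ^ n →
  Covers φ₁ φ₂ a′ b′ (a′ + b′) → InFace φ₁ a′ zero false →
  ∃[ ω ] ∀ x → val (fun ω x) < s ⇔
               (lookup x zero ≡ false × ¬ (lookup (inv φ₂ x) zero ≡ true × val (inv φ₂ x) < a′ + b′))
overflow-complement {n = n} {d = d} {s = s} {a′ = a′} {b′ = b′} φ₁ φ₂ b′≤ e es U F₁ =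
  let ω , Ω = face-complement (flipLeading ∘ᴬ φ₂ ⁻¹ᴬ) d≤ es overflow-in-face
  in ω , λ x → ⇔-trans (Ω x) (⇔-refl ×-⇔ ¬-⇔ (overflow (inv φ₂ x)))
  where
  d≤ : d ≤ 2 ^ n
  d≤ = ≤-trans (m≤m+n d s) (≤-reflexive es)
  overflow : (w : V (suc n)) → val (fun flipLeading w) < d ⇔ (lookup w zero ≡ true × val w < a′ + b′)
  overflow w = subst (λ u → val (fun flipLeading w) < d ⇔ (lookup w zero ≡ true × val w < u))
                     (sym e) (flipLeading-<⇔ w d≤)
  overflow-in-face : InFace (flipLeading ∘ᴬ φ₂ ⁻¹ᴬ) d zero false
  overflow-in-face x lt with w₀≡t , w< ← to (overflow (inv φ₂ x)) lt with from (U (inv φ₂ x)) w<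
  ... | inj₁ A = contradiction (trans (sym w₀≡t) (F₁ _ A)) λ ()
  ... | inj₂ B = from (head≡false⇔val< x) (<-≤-trans (subst (λ v → val v < b′) (inv-r φ₂ x) B) b′≤)

cover-complement-leading-face : ∀ {a′ b′} (φ₁ φ₂ : Aut (suc n)) →
  a′ ≤ 2 ^ n → b′ ≤ 2 ^ n → a′ + a ≡ 2 ^ n → b′ + b ≡ 2 ^ n →
  a′ + b′ ≡ t → t ≡ 2 ^ n + d → d + s ≡ 2 ^ n →
  Covers φ₁ φ₂ a′ b′ t → InFace φ₁ a′ zero false → Cover (suc n) a b s
cover-complement-leading-face {n = n} {b = b} {d = d} {s = s} {a′ = a′} {b′ = b′}
                              φ₁ φ₂ a′≤ b′≤ ea eb refl e es U F₁ =
  let ω , Ω = overflow-complement φ₁ φ₂ b′≤ e es U F₁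
      χ₁ , C₁ = face-complement φ₁ a′≤ ea F₁
  in χ₁ ∘ᴬ φ₂ ⁻¹ᴬ ∘ᴬ ω ⁻¹ᴬ , complementTail ∘ᴬ ω ⁻¹ᴬ , λ y →
       ⇔-trans (C₁ (inv φ₂ (inv ω y)) ⊎-⇔ tail-part (inv ω y))
      (⇔-trans (⇔-sym (pointwise (inv ω y)))
      (⇔-trans (⇔-sym (Ω (inv ω y)))
               (subst (λ v → val (fun ω (inv ω y)) < s ⇔ val v < s) (inv-r ω y) ⇔-refl)))
  where
  tail-part : (x : V (suc n)) → val (fun complementTail x) < b ⇔ (lookup x zero ≡ false × val (fun φ₂ (inv φ₂ x)) ≮ b′)
  tail-part x = ⇔-trans (complementTail-<⇔ x eb)
    (⇔-refl ×-⇔ subst (λ v → b′ ≤ val x ⇔ val v ≮ b′) (sym (inv-r φ₂ x)) (⇔-sym ≮⇔≥))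
  B⇒x₀ : (x : V (suc n)) → val (fun φ₂ (inv φ₂ x)) < b′ → lookup x zero ≡ false
  B⇒x₀ x B = from (head≡false⇔val< x) (<-≤-trans (subst (λ v → val v < b′) (inv-r φ₂ x) B) b′≤)
  w₀⇒L : (w : V (suc n)) → lookup w zero ≡ false → val w < a′ + b′
  w₀⇒L w w₀≡f = <-≤-trans (to (head≡false⇔val< w) w₀≡f) (≤-trans (m≤m+n (2 ^ n) d) (≤-reflexive (sym e)))
  pointwise : (x : V (suc n)) → let w = inv φ₂ x in
    (lookup x zero ≡ false × ¬ (lookup w zero ≡ true × val w < a′ + b′)) ⇔
    ((lookup w zero ≡ false × val (fun φ₁ w) ≮ a′) ⊎ (lookup x zero ≡ false × val (fun φ₂ w) ≮ b′))
  pointwise x = leading-face-pointwise (_ <? b′) (F₁ _) (B⇒x₀ x)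
    (covers-disjoint φ₁ φ₂ (+-mono-≤ a′≤ (≤-trans b′≤ (m≤m+n (2 ^ n) 0))) U _) (U _) (w₀⇒L (inv φ₂ x))

preimage-in-face : (φ : Aut (suc n)) → k₁ ≤ 2 ^ n → ∃₂ λ p β → InFace φ k₁ p β
preimage-in-face φ k≤ with p , β , P ← mapsCoord-to φ zero =
  p , β , mapsCoord⇒inFace φ P (λ x lt → from (head≡false⇔val< x) (<-≤-trans lt k≤))

-- I_k lies in the faces x₀ = false and x₁ = false; their preimage faces cannot both be that of coordinate 0.
quarter-preimage-in-face : (φ : Aut (suc (suc n))) → k₁ ≤ 2 ^ n → ∃₂ λ p β → p ≢ zero × InFace φ k₁ p β
quarter-preimage-in-face φ k≤ with mapsCoord-to φ zero | mapsCoord-to φ (suc zero)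
... | p₀ , β₀ , P₀ | p₁ , β₁ , P₁ with p₀ ≟ᶠ zero | p₁ ≟ᶠ zero
...   | no p₀≢0 | _        = p₀ , β₀ , p₀≢0 ,
  mapsCoord⇒inFace φ P₀ (λ x lt → proj₁ (from (first-two≡false⇔val< x) (<-≤-trans lt k≤)))
...   | yes _   | no p₁≢0  = p₁ , β₁ , p₁≢0 ,
  mapsCoord⇒inFace φ P₁ (λ x lt → proj₂ (from (first-two≡false⇔val< x) (<-≤-trans lt k≤)))
...   | yes refl | yes refl = contradiction (mapsCoord-injective φ P₀ P₁) λ ()

-- Test the hypothesis on the vector with coordinates p₁, p₂ set against the faces and zeros elsewhere.
two-faces-cover : (q p₁ p₂ : Fin N) (β₁ β₂ : Bool) →
  (∀ y → (∀ i → i ≢ p₁ → i ≢ p₂ → lookup y i ≡ false) → lookup y q ≡ false →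
         lookup y p₁ ≡ β₁ ⊎ lookup y p₂ ≡ β₂) →
  (p₁ ≡ p₂ × β₂ ≡ not β₁) ⊎ (p₁ ≡ q × β₁ ≡ false) ⊎ (p₂ ≡ q × β₂ ≡ false)
two-faces-cover {N} q p₁ p₂ β₁ β₂ cover
  with (p₁ ≟ᶠ p₂) ×-dec (β₂ ≟ᵇ not β₁) | (p₁ ≟ᶠ q) ×-dec (β₁ ≟ᵇ false) | (p₂ ≟ᶠ q) ×-dec (β₂ ≟ᵇ false)
... | yes opposite  | _      | _      = inj₁ opposite
... | no  _         | yes q₁ | _      = inj₂ (inj₁ q₁)
... | no  _         | no  _  | yes q₂ = inj₂ (inj₂ q₂)
... | no  ¬opposite | no ¬q₁ | no ¬q₂ =
  ⊥-elim ([ (λ e → not-¬ refl (trans (sym e) probe-p₁)) , probe-p₂ ]′ (cover probe outside q≡false))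
  where
  probe₂ = replicate N false [ p₂ ]≔ not β₂
  probe  = probe₂ [ p₁ ]≔ not β₁
  probe-p₁ : lookup probe p₁ ≡ not β₁
  probe-p₁ = lookup∘update p₁ probe₂ (not β₁)
  probe-other : ∀ {i} → i ≢ p₁ → lookup probe i ≡ lookup probe₂ i
  probe-other i≢p₁ = lookup∘update′ i≢p₁ probe₂ (not β₁)
  probe₂-p₂ : lookup probe₂ p₂ ≡ not β₂
  probe₂-p₂ = lookup∘update p₂ (replicate N false) (not β₂)
  probe₂-other : ∀ {i} → i ≢ p₂ → lookup probe₂ i ≡ false
  probe₂-other {i} i≢p₂ = trans (lookup∘update′ i≢p₂ (replicate N false) (not β₂)) (lookup-replicate i false)
  outside : ∀ i → i ≢ p₁ → i ≢ p₂ → lookup probe i ≡ false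
  outside i i≢p₁ i≢p₂ = trans (probe-other i≢p₁) (probe₂-other i≢p₂)
  q≡false : lookup probe q ≡ false
  q≡false with p₁ ≟ᶠ q | p₂ ≟ᶠ q
  ... | yes refl | _        = trans probe-p₁ (cong not (¬-not (¬q₁ ∘ (refl ,_))))
  ... | no p₁≢q  | yes refl = trans (probe-other (p₁≢q ∘ sym)) (trans probe₂-p₂ (cong not (¬-not (¬q₂ ∘ (refl ,_)))))
  ... | no p₁≢q  | no p₂≢q  = outside q (p₁≢q ∘ sym) (p₂≢q ∘ sym)
  probe-p₂ : lookup probe p₂ ≢ β₂
  probe-p₂ with p₁ ≟ᶠ p₂
  ... | yes refl = λ e → ¬opposite (refl , trans (sym e) probe-p₁)
  ... | no p₁≢p₂ = λ e → not-¬ refl (trans (sym e) (trans (probe-other (p₁≢p₂ ∘ sym)) probe₂-p₂))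

fit⇒complement-fit : a ≤ 2 ^ m → b ≤ 2 ^ m → 2 ^ m ≤ a + b → a + b ≤ 2 ^ suc m →
  Fit (suc (suc m)) a b → Fit (suc (suc m)) (2 ^ suc m ∸ a) (2 ^ suc m ∸ b)
fit⇒complement-fit {a} {m} {b} a≤h b≤h h≤t t≤H fit = from Fit⇔Cover (complementary-cover (to Fit⇔Cover fit))
  where
  H = 2 ^ suc m
  a≤H = ≤-trans a≤h (2^n≤2^[1+n] m)
  b≤H = ≤-trans b≤h (2^n≤2^[1+n] m)
  ea = m+[n∸m]≡n a≤H
  eb = m+[n∸m]≡n b≤H
  total : (a + b) + ((H ∸ a) + (H ∸ b)) ≡ 2 ^ suc (suc m)
  total = trans (interchange a b _ _) (trans (cong₂ _+_ ea eb) (cong (H +_) (sym (+-identityʳ H))))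
  complementary-cover : Cover (suc (suc m)) a b (a + b) → Cover (suc (suc m)) (H ∸ a) (H ∸ b) ((H ∸ a) + (H ∸ b))
  complementary-cover (φ₁ , φ₂ , U)
    with pA , βA , pA≢0 , FA ← quarter-preimage-in-face φ₁ a≤h
       | pB , βB , pB≢0 , FB ← quarter-preimage-in-face φ₂ b≤h
    with two-faces-cover (suc zero) pA pB βA βB (λ y outside y₁≡f →
           ⊎-map (FA y) (FB y) (from (U y) (<-≤-trans (to (first-two≡false⇔val< y)
                                  (outside zero (pA≢0 ∘ sym) (pB≢0 ∘ sym) , y₁≡f)) h≤t)))
  ... | inj₁ (refl , refl)        = cover-complement-opposite-faces φ₁ φ₂ a≤H b≤H ea eb total U FA FB
  ... | inj₂ (inj₁ (refl , refl)) = cover-complement-second-face φ₁ φ₂ a≤H b≤H ea eb refl h≤t t≤H total U FA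
  ... | inj₂ (inj₂ (refl , refl)) =
    Cover-swap (cover-complement-second-face φ₂ φ₁ b≤H a≤H eb ea (+-comm b a) h≤t t≤H total (covers-swap φ₁ φ₂ U) FB)

complement-fit⇒fit : a ≤ 2 ^ m → b ≤ 2 ^ m → 2 ^ m ≤ a + b → a + b ≤ 2 ^ suc m →
  Fit (suc (suc m)) (2 ^ suc m ∸ a) (2 ^ suc m ∸ b) → Fit (suc (suc m)) a b
complement-fit⇒fit {a} {m} {b} a≤h b≤h h≤t t≤H fit = from Fit⇔Cover (complementary-cover (to Fit⇔Cover fit))
  where
  H = 2 ^ suc m
  a′ = H ∸ a
  b′ = H ∸ b
  excess = H ∸ (a + b)
  a′≤ = m∸n≤m H a
  b′≤ = m∸n≤m H b
  ea′ : a′ + a ≡ H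
  ea′ = m∸n+n≡m (≤-trans a≤h (2^n≤2^[1+n] m))
  eb′ : b′ + b ≡ H
  eb′ = m∸n+n≡m (≤-trans b≤h (2^n≤2^[1+n] m))
  ed : excess + (a + b) ≡ H
  ed = m∸n+n≡m t≤H
  double : (a′ + b′) + (a + b) ≡ H + H
  double = trans (interchange a′ b′ a b) (cong₂ _+_ ea′ eb′)
  total : (a′ + b′) + (a + b) ≡ 2 ^ suc (suc m)
  total = trans double (cong (H +_) (sym (+-identityʳ H)))
  t≡ : a′ + b′ ≡ H + excess
  t≡ = +-cancelʳ-≡ (a + b) _ _ (trans double (sym (trans (+-assoc H excess (a + b)) (cong (H +_) ed))))
  complementary-cover : Cover (suc (suc m)) a′ b′ (a′ + b′) → Cover (suc (suc m)) a b (a + b)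
  complementary-cover (φ₁ , φ₂ , U)
    with p₁ , β₁ , F₁ ← preimage-in-face φ₁ a′≤
       | p₂ , β₂ , F₂ ← preimage-in-face φ₂ b′≤
    with two-faces-cover zero p₁ p₂ β₁ β₂ (λ y _ y₀≡f →
           ⊎-map (F₁ y) (F₂ y) (from (U y) (<-≤-trans (to (head≡false⇔val< y) y₀≡f)
                                  (≤-trans (m≤m+n H excess) (≤-reflexive (sym t≡))))))
  ... | inj₁ (refl , refl)        = cover-complement-opposite-faces φ₁ φ₂ a′≤ b′≤ ea′ eb′ total U F₁ F₂
  ... | inj₂ (inj₁ (refl , refl)) = cover-complement-leading-face φ₁ φ₂ a′≤ b′≤ ea′ eb′ refl t≡ ed U F₁
  ... | inj₂ (inj₂ (refl , refl)) =
    Cover-swap (cover-complement-leading-face φ₂ φ₁ b′≤ a′≤ eb′ ea′ (+-comm b′ a′) t≡ ed (covers-swap φ₁ φ₂ U) F₂)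

-- Counting unfit pairs

Fit-swap : Fit N a b → Fit N b a
Fit-swap {N} {a} {b} = from Fit⇔Cover ∘ subst (Cover N b a) (+-comm a b) ∘ Cover-swap ∘ to Fit⇔Cover

fit-half-quarter : ∀ m → Fit (suc (suc m)) (2 ^ suc m) (2 ^ m)
fit-half-quarter m = from Fit⇔Cover (idᴬ , flipLeading , λ y →
  ⇔-trans (⇔-sym (head≡false⇔val< y) ⊎-⇔ flipLeading-<⇔ y (2^n≤2^[1+n] m)) (by-leading y))
  where
  by-leading : ∀ y → (lookup y zero ≡ false ⊎ (lookup y zero ≡ true × val y < 2 ^ suc m + 2 ^ m)) ⇔
                     val y < 2 ^ suc m + 2 ^ m
  by-leading y = mk⇔ [ (λ y₀≡f → <-≤-trans (to (head≡false⇔val< y) y₀≡f) (m≤m+n _ _)) , proj₂ ]′ by-case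
    where
    by-case : val y < 2 ^ suc m + 2 ^ m → lookup y zero ≡ false ⊎ (lookup y zero ≡ true × val y < 2 ^ suc m + 2 ^ m)
    by-case lt with lookup y zero ≟ᵇ false
    ... | yes y₀≡f = inj₁ y₀≡f
    ... | no  y₀≢f = inj₂ (¬-not y₀≢f , lt)

reflected-fit⇔ : a ≤ 2 ^ m → b ≤ 2 ^ m → 2 ^ m ≤ a + b → a + b ≤ 2 ^ suc m →
  Fit (suc (suc m)) a b ⇔ Fit (suc (suc m)) (2 ^ suc m ∸ a) (2 ^ suc m ∸ b)
reflected-fit⇔ a≤ b≤ h≤ ≤H = mk⇔ (fit⇒complement-fit a≤ b≤ h≤ ≤H) (complement-fit⇒fit a≤ b≤ h≤ ≤H)

S₁ S₂ : ℕ → ℕ → ℕ → Set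
S₁ h x y = 1 ≤ x × 1 ≤ y × x ≤ h × y ≤ h × h ≤ x + y × x + y ≤ h + h
S₂ h x y = 1 ≤ x × 1 ≤ y × h ≤ x × h ≤ y × x + y ≤ (h + h) + h

T-≤ᵇ : T (x ≤ᵇ y) ⇔ x ≤ y
T-≤ᵇ {x} {y} = mk⇔ (≤ᵇ⇒≤ x y) ≤⇒≤ᵇ

T-inS₁ : ∀ {h} → T (inS₁ h x y) ⇔ S₁ h x y
T-inS₁ = ⇔-trans T-∧ (T-≤ᵇ ×-⇔ ⇔-trans T-∧ (T-≤ᵇ ×-⇔ ⇔-trans T-∧ (T-≤ᵇ ×-⇔ ⇔-trans T-∧
           (T-≤ᵇ ×-⇔ ⇔-trans T-∧ (T-≤ᵇ ×-⇔ T-≤ᵇ)))))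

T-inS₂ : ∀ {h} → T (inS₂ h x y) ⇔ S₂ h x y
T-inS₂ = ⇔-trans T-∧ (T-≤ᵇ ×-⇔ ⇔-trans T-∧ (T-≤ᵇ ×-⇔ ⇔-trans T-∧ (T-≤ᵇ ×-⇔ ⇔-trans T-∧ (T-≤ᵇ ×-⇔ T-≤ᵇ))))

quadruple : ∀ h → (h + h) + (h + h) ≡ h + ((h + h) + h)
quadruple = solve 1 (λ h → (h :+ h) :+ (h :+ h) := h :+ ((h :+ h) :+ h)) refl

S₁⇒reflected-S₂ : ∀ {h} → x + x′ ≡ h + h → y + y′ ≡ h + h → S₁ h x y → S₂ h x′ y′
S₁⇒reflected-S₂ {x} {x′} {y} {y′} {h} ex ey (1≤x , 1≤y , x≤h , y≤h , h≤x+y , _) =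
  ≤-trans 1≤h h≤x′ , ≤-trans 1≤h h≤y′ , h≤x′ , h≤y′ ,
  balance (trans (interchange x y x′ y′) (trans (cong₂ _+_ ex ey) (quadruple h))) h≤x+y
  where
  1≤h = ≤-trans 1≤x x≤h
  h≤x′ = balance (sym ex) x≤h
  h≤y′ = balance (sym ey) y≤h

S₂⇒reflected-S₁ : ∀ {h} → x + x′ ≡ h + h → y + y′ ≡ h + h → S₂ h x′ y′ → x′ ≢ h + h → y′ ≢ h + h → S₁ h x y
S₂⇒reflected-S₁ {x} {x′} {y} {y′} {h} ex ey (_ , _ , h≤x′ , h≤y′ , x′+y′≤) x′≢ y′≢ =
  positive ex x′≢ , positive ey y′≢ ,
  balance (trans (+-comm x′ x) ex) h≤x′ , balance (trans (+-comm y′ y) ey) h≤y′ ,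
  balance (sym (trans (interchange x′ y′ x y) (trans (cong₂ _+_ (trans (+-comm x′ x) ex) (trans (+-comm y′ y) ey))
                                                    (trans (quadruple h) (+-comm h _)))))
          x′+y′≤ ,
  balance (trans (interchange x′ y′ x y) (cong₂ _+_ (trans (+-comm x′ x) ex) (trans (+-comm y′ y) ey)))
          (+-mono-≤ h≤x′ h≤y′)
  where
  positive : ∀ {u u′} → u + u′ ≡ h + h → u′ ≢ h + h → 1 ≤ u
  positive {zero} e u′≢ = contradiction e u′≢
  positive {suc _} _ _  = s≤s z≤n

S₂-boundary : ∀ {h} → x ≡ h + h → S₂ h x y → y ≡ h
S₂-boundary {x} {y} {h} refl (_ , _ , _ , h≤y , x+y≤) =
  ≤-antisym (+-cancelˡ-≤ (h + h) y h x+y≤) h≤y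

T-∧-not : ∀ {s} {P : Set} (P? : Dec P) → T (s ∧ not ⌊ P? ⌋) ⇔ (T s × ¬ P)
T-∧-not P? = ⇔-trans T-∧ (⇔-refl ×-⇔ mk⇔ toWitnessFalse fromWitnessFalse)

-- The two pairs of S₂ without a partner in S₁, (2^{n}, 2^{n-1}) and its mirror image, are fit.
unfit-S₁⇔unfit-S₂ : ∀ m → a ≤ 2 ^ suc m → b ≤ 2 ^ suc m →
  let H = 2 ^ suc m ; F = Fit (suc (suc m)) in
  (S₁ (2 ^ m) (H ∸ a) (H ∸ b) × ¬ F (H ∸ a) (H ∸ b)) ⇔ (S₂ (2 ^ m) a b × ¬ F a b)
unfit-S₁⇔unfit-S₂ {a} {b} m a≤H b≤H = mk⇔
  (λ (s₁ , unfit) → S₁⇒reflected-S₂ ea′ eb′ s₁ , unfit ∘ from (fit⇔ s₁))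
  λ (s₂ , unfit) → S₁-of s₂ unfit , unfit ∘ to (fit⇔ (S₁-of s₂ unfit))
  where
  h = 2 ^ m
  H = 2 ^ suc m
  H≡ : H ≡ h + h
  H≡ = cong (h +_) (+-identityʳ h)
  ea′ : (H ∸ a) + a ≡ h + h
  ea′ = trans (m∸n+n≡m a≤H) H≡
  eb′ : (H ∸ b) + b ≡ h + h
  eb′ = trans (m∸n+n≡m b≤H) H≡
  fit⇔ : S₁ h (H ∸ a) (H ∸ b) → Fit (suc (suc m)) (H ∸ a) (H ∸ b) ⇔ Fit (suc (suc m)) a b
  fit⇔ (_ , _ , a′≤ , b′≤ , h≤ , ≤2h) =
    subst₂ (λ u v → Fit (suc (suc m)) (H ∸ a) (H ∸ b) ⇔ Fit (suc (suc m)) u v) (m∸[m∸n]≡n a≤H) (m∸[m∸n]≡n b≤H)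
      (reflected-fit⇔ a′≤ b′≤ h≤ (≤-trans ≤2h (≤-reflexive (sym H≡))))
  S₁-of : S₂ h a b → ¬ Fit (suc (suc m)) a b → S₁ h (H ∸ a) (H ∸ b)
  S₁-of s₂ unfit = S₂⇒reflected-S₁ ea′ eb′ s₂
    (λ a≡2h → unfit (subst₂ (Fit (suc (suc m))) (sym (trans a≡2h (sym H≡))) (sym (S₂-boundary a≡2h s₂))
                             (fit-half-quarter m)))
    (λ b≡2h → unfit (subst₂ (Fit (suc (suc m))) (sym (S₂-boundary b≡2h (swap-S₂ s₂))) (sym (trans b≡2h (sym H≡)))
                             (Fit-swap (fit-half-quarter m))))
    where
    swap-S₂ : ∀ {u v} → S₂ h u v → S₂ h v u
    swap-S₂ {u} {v} (1≤u , 1≤v , h≤u , h≤v , u+v≤) =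
      1≤v , 1≤u , h≤v , h≤u , subst (_≤ (h + h) + h) (+-comm u v) u+v≤

sumBelow : ℕ → (ℕ → ℕ) → ℕ
sumBelow M f = sum (map f (upTo M))

sum-concatMap : ∀ {A : Set} (f : A → List ℕ) xs → sum (concatMap f xs) ≡ sum (map (sum ∘ f) xs)
sum-concatMap f []       = refl
sum-concatMap f (x ∷ xs) = trans (sum-++ (f x) (concatMap f xs)) (cong (sum (f x) +_) (sum-concatMap f xs))

countPairs≡sumBelow : ∀ M p → countPairs M p ≡ sumBelow M (λ a → sumBelow M (λ b → indicator (p a b)))
countPairs≡sumBelow M p = sum-concatMap (λ a → map (λ b → indicator (p a b)) (upTo M)) (upTo M)

sumBelow-cong : ∀ {M} {f g : ℕ → ℕ} → (∀ i → i < M → f i ≡ g i) → sumBelow M f ≡ sumBelow M g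
sumBelow-cong f≗g = cong sum (map-cong-local (All.tabulate (λ i∈ → f≗g _ (∈-upTo⁻ i∈))))

sumBelow-suc : ∀ M f → sumBelow (suc M) f ≡ sumBelow M f + f M
sumBelow-suc M f = begin
  sum (map f (upTo (suc M)))       ≡⟨ cong (sum ∘ map f) (upTo-∷ʳ M) ⟨
  sum (map f (upTo M ++ [ M ]))    ≡⟨ cong sum (map-++ f (upTo M) [ M ]) ⟩
  sum (map f (upTo M) ++ [ f M ])  ≡⟨ sum-++ (map f (upTo M)) [ f M ] ⟩
  sumBelow M f + (f M + 0)         ≡⟨ cong (sumBelow M f +_) (+-identityʳ (f M)) ⟩
  sumBelow M f + f M               ∎
  where open ≡-Reasoning

sumBelow-truncate : ∀ {H M f} → H < M → (∀ i → H < i → i < M → f i ≡ 0) → sumBelow M f ≡ sumBelow (suc H) f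
sumBelow-truncate {H} {M} {f} H<M vanish = subst (λ M → sumBelow M f ≡ sumBelow (suc H) f) (m∸n+n≡m H<M)
                                                 (beyond (M ∸ suc H) (≤-reflexive (m∸n+n≡m H<M)))
  where
  beyond : ∀ L → L + suc H ≤ M → sumBelow (L + suc H) f ≡ sumBelow (suc H) f
  beyond zero    _  = refl
  beyond (suc L) ≤M = begin
    sumBelow (suc (L + suc H)) f                ≡⟨ sumBelow-suc (L + suc H) f ⟩
    sumBelow (L + suc H) f + f (L + suc H)      ≡⟨ cong₂ _+_ (beyond L (<⇒≤ ≤M)) (vanish _ (m≤n+m (suc H) L) ≤M) ⟩
    sumBelow (suc H) f + 0                      ≡⟨ +-identityʳ _ ⟩
    sumBelow (suc H) f                          ∎
    where open ≡-Reasoning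

map-∸-upTo : ∀ H → map (H ∸_) (upTo (suc H)) ≡ downFrom (suc H)
map-∸-upTo zero    = refl
map-∸-upTo (suc H) = cong (suc H ∷_) (begin
  map (suc H ∸_) (applyUpTo suc (suc H)) ≡⟨ map-applyUpTo suc (suc H ∸_) (suc H) ⟩
  applyUpTo (H ∸_) (suc H)               ≡⟨ map-upTo (H ∸_) (suc H) ⟨
  map (H ∸_) (upTo (suc H))              ≡⟨ map-∸-upTo H ⟩
  downFrom (suc H)                       ∎)
  where open ≡-Reasoning

sumBelow-reflect : ∀ H f → sumBelow (suc H) (f ∘ (H ∸_)) ≡ sumBelow (suc H) f
sumBelow-reflect H f = begin
  sum (map (f ∘ (H ∸_)) (upTo (suc H)))        ≡⟨ cong sum (map-∘ (upTo (suc H))) ⟩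
  sum (map f (map (H ∸_) (upTo (suc H))))      ≡⟨ cong (sum ∘ map f) (trans (map-∸-upTo H) (sym (reverse-upTo (suc H)))) ⟩
  sum (map f (reverse (upTo (suc H))))         ≡⟨ sum-↭ (map⁺ f (↭-reverse (upTo (suc H)))) ⟩
  sum (map f (upTo (suc H)))                   ∎
  where open ≡-Reasoning

sumBelow-zeros : ∀ M → sumBelow M (λ _ → 0) ≡ 0
sumBelow-zeros zero    = refl
sumBelow-zeros (suc M) = trans (sumBelow-suc M (λ _ → 0)) (trans (+-identityʳ _) (sumBelow-zeros M))

indicator-outside : ∀ {H i} {c : Bool} → (c ≡ true → i ≤ H) → H < i → indicator c ≡ 0
indicator-outside {c = false} _      _   = refl
indicator-outside {c = true}  inside H<i = contradiction (inside refl) (<⇒≱ H<i)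

countPairs-restrict : ∀ {H M} (p : ℕ → ℕ → Bool) → H < M → (∀ a b → p a b ≡ true → a ≤ H × b ≤ H) →
  countPairs M p ≡ sumBelow (suc H) (λ a → sumBelow (suc H) (λ b → indicator (p a b)))
countPairs-restrict {H} {M} p H<M support = begin
  countPairs M p                                                      ≡⟨ countPairs≡sumBelow M p ⟩
  sumBelow M (λ a → sumBelow M (λ b → indicator (p a b)))             ≡⟨ sumBelow-cong {M} (λ a _ → inner a) ⟩
  sumBelow M (λ a → sumBelow (suc H) (λ b → indicator (p a b)))       ≡⟨ sumBelow-truncate H<M (λ a H<a _ → outer a H<a) ⟩
  sumBelow (suc H) (λ a → sumBelow (suc H) (λ b → indicator (p a b))) ∎
  where
  open ≡-Reasoning
  inner : ∀ a → sumBelow M (λ b → indicator (p a b)) ≡ sumBelow (suc H) (λ b → indicator (p a b))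
  inner a = sumBelow-truncate H<M (λ b H<b _ → indicator-outside (proj₂ ∘ support a b) H<b)
  outer : ∀ a → H < a → sumBelow (suc H) (λ b → indicator (p a b)) ≡ 0
  outer a H<a = trans (sumBelow-cong {suc H} (λ b _ → indicator-outside (proj₁ ∘ support a b) H<a))
                      (sumBelow-zeros (suc H))

countPairs-reflect : ∀ {H M} (p q : ℕ → ℕ → Bool) → H < M →
  (∀ a b → p a b ≡ true → a ≤ H × b ≤ H) → (∀ a b → q a b ≡ true → a ≤ H × b ≤ H) →
  (∀ a b → a ≤ H → b ≤ H → p (H ∸ a) (H ∸ b) ≡ q a b) → countPairs M p ≡ countPairs M q
countPairs-reflect {H} {M} p q H<M support-p support-q reflect = begin
  countPairs M p                                                            ≡⟨ countPairs-restrict p H<M support-p ⟩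
  sumBelow (suc H) (λ a → sumBelow (suc H) (λ b → indicator (p a b)))       ≡⟨ sumBelow-reflect H _ ⟨
  sumBelow (suc H) (λ a → sumBelow (suc H) (λ b → indicator (p (H ∸ a) b))) ≡⟨ sumBelow-cong {suc H} (λ a a<1+H → row a (≤-pred a<1+H)) ⟩
  sumBelow (suc H) (λ a → sumBelow (suc H) (λ b → indicator (q a b)))       ≡⟨ countPairs-restrict q H<M support-q ⟨
  countPairs M q                                                            ∎
  where
  open ≡-Reasoning
  row : ∀ a → a ≤ H → sumBelow (suc H) (λ b → indicator (p (H ∸ a) b)) ≡ sumBelow (suc H) (λ b → indicator (q a b))
  row a a≤H = trans (sym (sumBelow-reflect H _))
                    (sumBelow-cong {suc H} λ b b<1+H → cong indicator (reflect a b a≤H (≤-pred b<1+H)))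

unfit-count-reflect : ∀ m (d : ∀ a b → Dec (Fit (suc (suc m)) a b)) →
  countUnfit (suc (suc m)) (suc (2 ^ suc (suc m))) d (inS₁ (2 ^ m))
    ≡ countUnfit (suc (suc m)) (suc (2 ^ suc (suc m))) d (inS₂ (2 ^ m))
unfit-count-reflect m d = countPairs-reflect _ _ (s≤s (2^n≤2^[1+n] (suc m))) support₁ support₂
  (λ a b a≤ b≤ → ⇔→≡ (⇔-trans unfit₁ (⇔-trans (unfit-S₁⇔unfit-S₂ m a≤ b≤) (⇔-sym unfit₂))))
  where
  h = 2 ^ m
  H≡ : 2 ^ suc m ≡ h + h
  H≡ = cong (h +_) (+-identityʳ h)
  unfit₁ : ∀ {a b} → (inS₁ h a b ∧ not ⌊ d a b ⌋) ≡ true ⇔ (S₁ h a b × ¬ Fit (suc (suc m)) a b)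
  unfit₁ {a} {b} = ⇔-trans (⇔-sym T-≡) (⇔-trans (T-∧-not (d a b)) (T-inS₁ ×-⇔ ⇔-refl))
  unfit₂ : ∀ {a b} → (inS₂ h a b ∧ not ⌊ d a b ⌋) ≡ true ⇔ (S₂ h a b × ¬ Fit (suc (suc m)) a b)
  unfit₂ {a} {b} = ⇔-trans (⇔-sym T-≡) (⇔-trans (T-∧-not (d a b)) (T-inS₂ ×-⇔ ⇔-refl))
  support₁ : ∀ a b → (inS₁ h a b ∧ not ⌊ d a b ⌋) ≡ true → a ≤ 2 ^ suc m × b ≤ 2 ^ suc m
  support₁ a b e with (_ , _ , a≤h , b≤h , _) , _ ← to unfit₁ e =
    ≤-trans a≤h (2^n≤2^[1+n] m) , ≤-trans b≤h (2^n≤2^[1+n] m)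
  support₂ : ∀ a b → (inS₂ h a b ∧ not ⌊ d a b ⌋) ≡ true → a ≤ 2 ^ suc m × b ≤ 2 ^ suc m
  support₂ a b e with (_ , _ , h≤a , h≤b , a+b≤) , _ ← to unfit₂ e =
    ≤-trans (+-cancelʳ-≤ h a (h + h) (≤-trans (+-monoʳ-≤ a h≤b) a+b≤)) (≤-reflexive (sym H≡)) ,
    ≤-trans (+-cancelʳ-≤ h b (h + h) (≤-trans (+-monoʳ-≤ b h≤a) (≤-trans (≤-reflexive (+-comm b a)) a+b≤)))
            (≤-reflexive (sym H≡))

mainTheorem6 : (n : ℕ) → 1 ≤ n →
    (∀ (a b : ℕ) → 0 < a → 0 < b → a ≤ 2 ^ (n ∸ 1) → b ≤ 2 ^ (n ∸ 1) →
      2 ^ (n ∸ 1) ≤ a + b → a + b ≤ 2 ^ n →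
      Fit (suc n) a b ⇔ Fit (suc n) (2 ^ n ∸ a) (2 ^ n ∸ b))
    × (∀ (d : ∀ a b → Dec (Fit (suc n) a b)) →
      countUnfit (suc n) (suc (2 ^ suc n)) d (inS₁ (2 ^ (n ∸ 1)))
        ≡ countUnfit (suc n) (suc (2 ^ suc n)) d (inS₂ (2 ^ (n ∸ 1))))
mainTheorem6 (suc m) _ = (λ _ _ _ _ → reflected-fit⇔) , unfit-count-reflect m
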